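{- Let $G$ be a finite simple graph on $[d]$. Then $K_G=\langle[I_G]_2\rangle+M_G$.
   Context: $G$ is a simple graph on $[d]$, $\mathbb{K}$ a field, $S(G)$ the set of stable sets of $G$ (subsets of $[d]$ with no edge; includes $\emptyset$ and singletons), $R[G]=\mathbb{K}[x_S:S\in S(G)]$ with all $\deg x_S=1$. $I_G$ is the kernel of the $\mathbb{K}$-algebra map $R[G]\to\mathbb{K}[t_1,\dots,t_d,s]$, $x_S\mapsto(\prod_{j\in S}t_j)s$, and $\langle[I_G]_2\rangle$ is the ideal generated by the quadratic binomials in $I_G$. For a $2$-coloring $f$ (map to $\{1,2\}$ with adjacent vertices colored differently) of an induced subgraph of $G$, ${\mathbf x}_f=x_{f^{ -1}(1)}x_{f^{ -1}(2)}$. $J_G$ is generated by all ${\mathbf x}_f-{\mathbf x}_g$ with $f,g$ $2$-colorings of the same induced subgraph of $G$. $M_G=\langle x_Sx_T : S,T\in S(G),\ S\cap T\neq\emptyset\rangle$, and $K_G=J_G+M_G$. -}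

module Defs where

open import Level using (Level; _⊔_; Lift)
open import Data.Nat using (ℕ; zero; suc) renaming (_+_ to _+ℕ_; _≟_ to _≟ℕ_)
open import Data.Bool using (Bool; true; false; if_then_else_; _∧_)
open import Data.Bool.Properties using () renaming (_≟_ to _≟B_)
open import Data.Fin using (Fin)
open import Data.Fin.Subset using (Subset; _∈_)
open import Data.Vec using (Vec; lookup; tabulate; replicate; zipWith)
open import Data.Vec.Properties using (≡-dec)
open import Data.List using (List; []; _∷_; _++_; map; concatMap; foldr; length)
open import Data.List.Relation.Unary.All using (All)
open import Data.Maybe using (Maybe; just; nothing)
open import Data.Product using (Σ; ∃; ∃-syntax; _×_; _,_; proj₁; proj₂)
open import Relation.Nullary using (¬_; Dec; yes; no; does)
open import Relation.Binary.PropositionalEquality using (_≡_; _≢_)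
open import Algebra.Bundles using (CommutativeRing)

record IsField {c ℓ : Level} (K : CommutativeRing c ℓ) : Set (c ⊔ ℓ) where
  open CommutativeRing K
  field
    1≉0     : ¬ (1# ≈ 0#)
    inverse : ∀ x → ¬ (x ≈ 0#) → Σ Carrier (λ y → (x * y) ≈ 1#)

record SimpleGraph (d : ℕ) : Set where
  field
    Adj     : Fin d → Fin d → Bool
    symm    : ∀ i j → Adj i j ≡ Adj j i
    irrefl  : ∀ i → Adj i i ≡ false
open SimpleGraph public

Stable : ∀ {d} → SimpleGraph d → Subset d → Set
Stable G S = ∀ i j → i ∈ S → j ∈ S → Adj G i j ≡ false

-- variables x_S of R[G], S ∈ S(G)
Var : ∀ {d} → SimpleGraph d → Set
Var {d} G = Σ (Subset d) (Stable G)

-- A 2-colouring of the induced subgraph G[W] is a colour map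
-- col : W → {1,2} (encoded as true = colour 1, false = colour 2; the
-- values outside W are irrelevant) such that adjacent vertices of W get
-- different colours.

record Coloring {d} (G : SimpleGraph d) (W : Subset d) : Set where
  field
    col    : Fin d → Bool
    proper : ∀ i j → i ∈ W → j ∈ W → Adj G i j ≡ true → col i ≢ col j

colorClass1 : ∀ {d} {G : SimpleGraph d} {W} → Coloring G W → Subset d
colorClass1 {W = W} f = tabulate (λ i → lookup W i ∧ Coloring.col f i)

colorClass2 : ∀ {d} {G : SimpleGraph d} {W} → Coloring G W → Subset d
colorClass2 {W = W} f = tabulate (λ i → lookup W i ∧ (if Coloring.col f i then false else true))

module PolyRing {c ℓ : Level} (K : CommutativeRing c ℓ) {d : ℕ} (G : SimpleGraph d) where
  open CommutativeRing K

  -- monomials: finite multisets of variables (a list, up to order)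
  Mono : Set
  Mono = List (Var G)

  -- polynomials: formal finite sums of coefficient * monomial
  Term : Set c
  Term = Carrier × Mono

  Poly : Set c
  Poly = List Term

  _≟V_ : (a b : Var G) → Dec (proj₁ a ≡ proj₁ b)
  a ≟V b = ≡-dec _≟B_ (proj₁ a) (proj₁ b)

  removeV : Var G → Mono → Maybe Mono
  removeV a []       = nothing
  removeV a (b ∷ bs) with does (a ≟V b)
  ... | true  = just bs
  ... | false with removeV a bs
  ...   | nothing = nothing
  ...   | just bs' = just (b ∷ bs')

  sameMono : Mono → Mono → Bool
  sameMono []       []       = true
  sameMono []       (_ ∷ _)  = false
  sameMono (a ∷ as) bs with removeV a bs
  ... | nothing  = false
  ... | just bs' = sameMono as bs'

  coeff : Poly → Mono → Carrier
  coeff []             m = 0#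
  coeff ((k , n) ∷ ts) m = (if sameMono n m then k else 0#) + coeff ts m

  _≈P_ : Poly → Poly → Set ℓ
  p ≈P q = ∀ m → coeff p m ≈ coeff q m

  _⊕_ : Poly → Poly → Poly
  p ⊕ q = p ++ q

  _⊗_ : Poly → Poly → Poly
  p ⊗ q = concatMap (λ t → map (λ u → (proj₁ t * proj₁ u , proj₂ t ++ proj₂ u)) q) p

  ⊝_ : Poly → Poly
  ⊝ p = map (λ t → (- proj₁ t , proj₂ t)) p

  mono : Mono → Poly
  mono m = (1# , m) ∷ []

  linComb : List (Poly × Poly) → Poly
  linComb = foldr (λ hg acc → (proj₁ hg ⊗ proj₂ hg) ⊕ acc) []

  Ideal⟨_⟩ : (Poly → Set (c ⊔ ℓ)) → Poly → Set (c ⊔ ℓ)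
  Ideal⟨ Gen ⟩ f = Σ (List (Poly × Poly)) λ L → All (λ hg → Gen (proj₂ hg)) L × f ≈P linComb L

  _+I_ : (Poly → Set (c ⊔ ℓ)) → (Poly → Set (c ⊔ ℓ)) → Poly → Set (c ⊔ ℓ)
  (I +I J) f = Σ Poly λ a → Σ Poly λ b → I a × J b × f ≈P (a ⊕ b)

  -- The map φ : R[G] → K[t_1..t_d, s], x_S ↦ (∏_{j∈S} t_j) s.
  -- A monomial of K[t,s] is an exponent vector (e, k) ∈ ℕ^d × ℕ.

  indicator : Subset d → Vec ℕ d
  indicator S = tabulate (λ j → if lookup S j then 1 else 0)

  φexp : Mono → Vec ℕ d × ℕ
  φexp m = foldr (λ a acc → zipWith _+ℕ_ (indicator (proj₁ a)) acc) (replicate d 0) m , length m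

  φcoeff : Poly → Vec ℕ d → ℕ → Carrier
  φcoeff []             e k = 0#
  φcoeff ((a , m) ∷ ts) e k =
    (if (does (≡-dec _≟ℕ_ (proj₁ (φexp m)) e) ∧ does (proj₂ (φexp m) ≟ℕ k)) then a else 0#)
    + φcoeff ts e k

  InI : Poly → Set ℓ
  InI p = ∀ e k → φcoeff p e k ≈ 0#

  QuadBinomialInI : Poly → Set (c ⊔ ℓ)
  QuadBinomialInI p =
    Σ Carrier λ a → Σ Carrier λ b → Σ (Var G) λ S → Σ (Var G) λ T → Σ (Var G) λ U → Σ (Var G) λ V →
      (p ≡ (a , S ∷ T ∷ []) ∷ (b , U ∷ V ∷ []) ∷ []) × InI p

  MGen : Poly → Set (c ⊔ ℓ)
  MGen p = Σ (Var G) λ S → Σ (Var G) λ T →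
    (Σ (Fin d) λ i → i ∈ proj₁ S × i ∈ proj₁ T) × Lift ℓ (p ≡ mono (S ∷ T ∷ []))

  JGen : Poly → Set (c ⊔ ℓ)
  JGen p = Lift ℓ (Σ (Subset d) λ W → Σ (Coloring G W) λ f → Σ (Coloring G W) λ g →
    Σ (Var G) λ f1 → Σ (Var G) λ f2 → Σ (Var G) λ g1 → Σ (Var G) λ g2 →
      proj₁ f1 ≡ colorClass1 f × proj₁ f2 ≡ colorClass2 f ×
      proj₁ g1 ≡ colorClass1 g × proj₁ g2 ≡ colorClass2 g ×
      (p ≡ mono (f1 ∷ f2 ∷ []) ⊕ (⊝ mono (g1 ∷ g2 ∷ []))))

  J-G M-G K-G Q-G : Poly → Set (c ⊔ ℓ)
  J-G = Ideal⟨ JGen ⟩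
  M-G = Ideal⟨ MGen ⟩
  K-G = J-G +I M-G
  Q-G = Ideal⟨ QuadBinomialInI ⟩

{-# OPTIONS --safe #-}

-- A quadratic binomial a·x_S x_T + b·x_U x_V lies in I_G exactly when either a = b = 0, or both
-- monomials have the same image t^(1_S + 1_T) s² and b = −a. As 1_S + 1_T = 1_(S∩T) + 1_(S∪T),
-- equal images mean S ∩ T = U ∩ V and S ∪ T = U ∪ V. If S and T meet, so do U and V, and both
-- monomials lie in M_G. Otherwise S ⊔ T = U ⊔ V =: W, and colouring W by membership in S, resp.
-- in U, exhibits x_S x_T − x_U x_V as a generator of J_G. Conversely, the two colour classes of a
-- 2-colouring of G[W] are disjoint with union W, so every generator of J_G is such a binomial.
-- Hence J_G ⊆ ⟨[I_G]₂⟩ ⊆ J_G + M_G.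

module Submission where

open import Defs
open import Level using (Level; _⊔_; lift)
open import Data.Bool using (Bool; true; false; if_then_else_; _∧_; _∨_)
open import Data.Bool.Properties using (∧-comm; ∧-abs-∨)
open import Data.Empty using (⊥-elim)
open import Data.Fin using (Fin)
open import Data.Fin.Properties using (any?)
open import Data.Fin.Subset using (Subset; _∈_; _∩_; _∪_) renaming (⊥ to ∅)
open import Data.Fin.Subset.Properties using (_∈?_; Empty-unique; x∈p∩q⁺; x∈p∩q⁻; x∈p∪q⁻)
open import Data.List using ([]; _∷_; _++_; map)
open import Data.List.Properties using (++-assoc; map-++)
open import Data.List.Relation.Unary.All using (All; []; _∷_)
import Data.List.Relation.Unary.All as All
open import Data.List.Relation.Unary.All.Properties using (++⁺)
open import Data.Nat using (ℕ) renaming (_+_ to _+ℕ_; _≟_ to _≟ℕ_)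
import Data.Nat.Properties as ℕ
open import Data.Product using (Σ; _×_; _,_; proj₁; proj₂)
import Data.Product.Properties as Product
open import Data.Sum using ([_,_]′)
open import Data.Vec using (Vec; lookup; tabulate; zipWith)
open import Data.Vec.Properties using (≡-dec; lookup-zipWith; lookup-replicate; lookup∘tabulate; tabulate∘lookup; tabulate-cong; []=⇒lookup; lookup⇒[]=)
open import Function.Base using (_∘_)
open import Function.Bundles using (_⇔_; mk⇔; Equivalence)
open import Relation.Nullary using (¬_; Dec; yes; no; does)
open import Relation.Nullary.Decidable using (_×-dec_; dec-true; dec-false)
open import Relation.Binary.PropositionalEquality using (_≡_; _≢_; refl; sym; trans; cong; cong₂; subst)
open import Algebra.Bundles using (CommutativeRing)
import Algebra.Properties.Ring as RingProperties
import Algebra.Properties.CommutativeSemigroup as CommutativeSemigroupProperties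

χ : Bool → ℕ
χ b = if b then 1 else 0

χ-+⇒∧-∨ : ∀ s t u v → χ s +ℕ χ t ≡ χ u +ℕ χ v → s ∧ t ≡ u ∧ v × s ∨ t ≡ u ∨ v
χ-+⇒∧-∨ true  true  true  true  _ = refl , refl
χ-+⇒∧-∨ true  true  true  false ()
χ-+⇒∧-∨ true  true  false true  ()
χ-+⇒∧-∨ true  true  false false ()
χ-+⇒∧-∨ true  false true  true  ()
χ-+⇒∧-∨ true  false true  false _ = refl , refl
χ-+⇒∧-∨ true  false false true  _ = refl , refl
χ-+⇒∧-∨ true  false false false ()
χ-+⇒∧-∨ false true  true  true  ()
χ-+⇒∧-∨ false true  true  false _ = refl , refl
χ-+⇒∧-∨ false true  false true  _ = refl , refl
χ-+⇒∧-∨ false true  false false ()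
χ-+⇒∧-∨ false false true  true  ()
χ-+⇒∧-∨ false false true  false ()
χ-+⇒∧-∨ false false false true  ()
χ-+⇒∧-∨ false false false false _ = refl , refl

χ-+≡χ-∧+χ-∨ : ∀ s t → χ s +ℕ χ t ≡ χ (s ∧ t) +ℕ χ (s ∨ t)
χ-+≡χ-∧+χ-∨ true  true  = refl
χ-+≡χ-∧+χ-∨ true  false = refl
χ-+≡χ-∧+χ-∨ false t     = refl

∨-∧-¬ˡ-disjoint : ∀ s t → s ∧ t ≡ false → (s ∨ t) ∧ (if s then false else true) ≡ t
∨-∧-¬ˡ-disjoint true  true  ()
∨-∧-¬ˡ-disjoint true  false _ = refl
∨-∧-¬ˡ-disjoint false true  _ = refl
∨-∧-¬ˡ-disjoint false false _ = refl

∧-∧¬-disjoint : ∀ w c → (w ∧ c) ∧ (w ∧ (if c then false else true)) ≡ false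
∧-∧¬-disjoint true  true  = refl
∧-∧¬-disjoint true  false = refl
∧-∧¬-disjoint false c     = refl

∧-∨∧¬-covers : ∀ w c → (w ∧ c) ∨ (w ∧ (if c then false else true)) ≡ w
∧-∨∧¬-covers true  true  = refl
∧-∨∧¬-covers true  false = refl
∧-∨∧¬-covers false c     = refl

lookup-extensionality : ∀ {A : Set} {n} {u v : Vec A n} → (∀ i → lookup u i ≡ lookup v i) → u ≡ v
lookup-extensionality {u = u} {v} u≗v =
  trans (sym (tabulate∘lookup u)) (trans (tabulate-cong u≗v) (tabulate∘lookup v))

module _ {c ℓ : Level} (K : CommutativeRing c ℓ) {d : ℕ} (G : SimpleGraph d) where
  open CommutativeRing K renaming (refl to ≈-refl; sym to ≈-sym; trans to ≈-trans)
  open RingProperties ring using (-‿distribʳ-*; +-inverseʳ-unique)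
  open CommutativeSemigroupProperties +-commutativeSemigroup using (interchange)
  open import Relation.Binary.Reasoning.Setoid setoid
  open PolyRing K G

  coeff-⊕ : ∀ p q m → coeff (p ⊕ q) m ≈ coeff p m + coeff q m
  coeff-⊕ []            q m = ≈-sym (+-identityˡ _)
  coeff-⊕ ((k , n) ∷ p) q m = ≈-trans (+-congˡ (coeff-⊕ p q m)) (≈-sym (+-assoc _ _ _))

  ⊕-cong : ∀ {p p′ q q′} → p ≈P p′ → q ≈P q′ → (p ⊕ q) ≈P (p′ ⊕ q′)
  ⊕-cong {p} {p′} {q} {q′} p≈p′ q≈q′ m = begin
    coeff (p ⊕ q) m         ≈⟨ coeff-⊕ p q m ⟩
    coeff p m + coeff q m   ≈⟨ +-cong (p≈p′ m) (q≈q′ m) ⟩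
    coeff p′ m + coeff q′ m ≈⟨ coeff-⊕ p′ q′ m ⟨
    coeff (p′ ⊕ q′) m       ∎

  ⊗-distribˡ-⊕ : ∀ h p q → (h ⊗ (p ⊕ q)) ≈P ((h ⊗ p) ⊕ (h ⊗ q))
  ⊗-distribˡ-⊕ []      p q m = ≈-refl
  ⊗-distribˡ-⊕ (t ∷ h) p q m = begin
    coeff ((t ∷ h) ⊗ (p ⊕ q)) m
      ≈⟨ coeff-⊕ tp⊕q _ m ⟩
    coeff tp⊕q m + coeff (h ⊗ (p ⊕ q)) m
      ≈⟨ +-cong (≈-trans (reflexive (cong (λ r → coeff r m) (map-++ (t ·_) p q))) (coeff-⊕ tp tq m))
                (⊗-distribˡ-⊕ h p q m) ⟩
    (coeff tp m + coeff tq m) + coeff ((h ⊗ p) ⊕ (h ⊗ q)) m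
      ≈⟨ +-congˡ (coeff-⊕ (h ⊗ p) _ m) ⟩
    (coeff tp m + coeff tq m) + (coeff (h ⊗ p) m + coeff (h ⊗ q) m)
      ≈⟨ interchange _ _ _ _ ⟩
    (coeff tp m + coeff (h ⊗ p) m) + (coeff tq m + coeff (h ⊗ q) m)
      ≈⟨ +-cong (coeff-⊕ tp _ m) (coeff-⊕ tq _ m) ⟨
    coeff ((t ∷ h) ⊗ p) m + coeff ((t ∷ h) ⊗ q) m
      ≈⟨ coeff-⊕ ((t ∷ h) ⊗ p) _ m ⟨
    coeff (((t ∷ h) ⊗ p) ⊕ ((t ∷ h) ⊗ q)) m
      ∎
    where
      _·_ : Term → Term → Term
      t · u = (proj₁ t * proj₁ u , proj₂ t ++ proj₂ u)
      tp tq tp⊕q : Poly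
      tp = map (t ·_) p
      tq = map (t ·_) q
      tp⊕q = map (t ·_) (p ⊕ q)

  scale : Poly → Carrier → Poly
  scale h a = map (λ t → (proj₁ t * a , proj₂ t)) h

  if-congˡ : ∀ x {a b} → a ≈ b → (if x then a else 0#) ≈ (if x then b else 0#)
  if-congˡ true  a≈b = a≈b
  if-congˡ false a≈b = ≈-refl

  if-≈0 : ∀ x {a} → a ≈ 0# → (if x then a else 0#) ≈ 0#
  if-≈0 true  a≈0 = a≈0
  if-≈0 false a≈0 = ≈-refl

  ⊗-singleton : ∀ h {a a′ b m} → a′ ≈ a * b → (h ⊗ ((a′ , m) ∷ [])) ≈P (scale h a ⊗ ((b , m) ∷ []))
  ⊗-singleton []            a′≈ab mo = ≈-refl
  ⊗-singleton ((k , n) ∷ h) a′≈ab mo =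
    +-cong (if-congˡ _ (≈-trans (*-congˡ a′≈ab) (≈-sym (*-assoc _ _ _)))) (⊗-singleton h a′≈ab mo)

  ⊗-singleton-≈0 : ∀ h {a m} → a ≈ 0# → (h ⊗ ((a , m) ∷ [])) ≈P []
  ⊗-singleton-≈0 []            a≈0 mo = ≈-refl
  ⊗-singleton-≈0 ((k , n) ∷ h) a≈0 mo =
    ≈-trans (+-cong (if-≈0 _ (≈-trans (*-congˡ a≈0) (zeroʳ k))) (⊗-singleton-≈0 h a≈0 mo)) (+-identityˡ 0#)

  binomial : Carrier → Mono → Carrier → Mono → Poly
  binomial a m b n = (a , m) ∷ (b , n) ∷ []

  coeff-⊗-binomial : ∀ h a m b n mo →
    coeff (h ⊗ binomial a m b n) mo ≈ coeff (h ⊗ ((a , m) ∷ [])) mo + coeff (h ⊗ ((b , n) ∷ [])) mo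
  coeff-⊗-binomial h a m b n mo =
    ≈-trans (⊗-distribˡ-⊕ h ((a , m) ∷ []) _ mo) (coeff-⊕ (h ⊗ ((a , m) ∷ [])) _ mo)

  ⊗-binomial-≈0 : ∀ h {a b m n} → a ≈ 0# → b ≈ 0# → (h ⊗ binomial a m b n) ≈P []
  ⊗-binomial-≈0 h {a} {b} {m} {n} a≈0 b≈0 mo =
    ≈-trans (coeff-⊗-binomial h a m b n mo)
      (≈-trans (+-cong (⊗-singleton-≈0 h a≈0 mo) (⊗-singleton-≈0 h b≈0 mo)) (+-identityˡ 0#))

  ⊗-binomial-split : ∀ h a m b n →
    (h ⊗ binomial a m b n) ≈P ((scale h a ⊗ mono m) ⊕ (scale h b ⊗ mono n))
  ⊗-binomial-split h a m b n mo = begin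
    coeff (h ⊗ binomial a m b n) mo
      ≈⟨ coeff-⊗-binomial h a m b n mo ⟩
    coeff (h ⊗ ((a , m) ∷ [])) mo + coeff (h ⊗ ((b , n) ∷ [])) mo
      ≈⟨ +-cong (⊗-singleton h (≈-sym (*-identityʳ a)) mo) (⊗-singleton h (≈-sym (*-identityʳ b)) mo) ⟩
    coeff (scale h a ⊗ mono m) mo + coeff (scale h b ⊗ mono n) mo
      ≈⟨ coeff-⊕ (scale h a ⊗ mono m) _ mo ⟨
    coeff ((scale h a ⊗ mono m) ⊕ (scale h b ⊗ mono n)) mo
      ∎

  ⊗-binomial-difference : ∀ h a m b n → b ≈ - a →
    (h ⊗ binomial a m b n) ≈P (scale h a ⊗ binomial 1# m (- 1#) n)
  ⊗-binomial-difference h a m b n b≈-a mo = begin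
    coeff (h ⊗ binomial a m b n) mo
      ≈⟨ coeff-⊗-binomial h a m b n mo ⟩
    coeff (h ⊗ ((a , m) ∷ [])) mo + coeff (h ⊗ ((b , n) ∷ [])) mo
      ≈⟨ +-cong (⊗-singleton h (≈-sym (*-identityʳ a)) mo) (⊗-singleton h b≈a*-1 mo) ⟩
    coeff (scale h a ⊗ mono m) mo + coeff (scale h a ⊗ ((- 1# , n) ∷ [])) mo
      ≈⟨ coeff-⊗-binomial (scale h a) 1# m (- 1#) n mo ⟨
    coeff (scale h a ⊗ binomial 1# m (- 1#) n) mo
      ∎
    where
      b≈a*-1 : b ≈ a * - 1#
      b≈a*-1 = ≈-trans b≈-a (≈-trans (-‿cong (≈-sym (*-identityʳ a))) (-‿distribʳ-* a 1#))

  record AdditivelyClosed (I : Poly → Set (c ⊔ ℓ)) : Set (c ⊔ ℓ) where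
    field
      ∈-resp-≈P : ∀ {p q} → p ≈P q → I p → I q
      []∈       : I []
      ⊕∈        : ∀ {p q} → I p → I q → I (p ⊕ q)
  open AdditivelyClosed

  linComb-++ : ∀ L L′ → linComb (L ++ L′) ≡ linComb L ⊕ linComb L′
  linComb-++ []            L′ = refl
  linComb-++ ((h , g) ∷ L) L′ =
    trans (cong ((h ⊗ g) ++_) (linComb-++ L L′)) (sym (++-assoc (h ⊗ g) _ _))

  Ideal-closed : ∀ Gen → AdditivelyClosed Ideal⟨ Gen ⟩
  Ideal-closed Gen = record
    { ∈-resp-≈P = λ p≈q (L , gens , p≈L) → L , gens , λ m → ≈-trans (≈-sym (p≈q m)) (p≈L m)
    ; []∈       = [] , [] , λ m → ≈-refl
    ; ⊕∈        = λ {p} {q} (L , gens , p≈L) (L′ , gens′ , q≈L′) →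
        L ++ L′ , ++⁺ gens gens′ , λ m → begin
          coeff (p ⊕ q) m                              ≈⟨ ⊕-cong {p} {linComb L} p≈L q≈L′ m ⟩
          coeff (linComb L ⊕ linComb L′) m             ≡⟨ cong (λ r → coeff r m) (linComb-++ L L′) ⟨
          coeff (linComb (L ++ L′)) m                  ∎
    }

  generator-multiple∈Ideal : ∀ {Gen} h g → Gen g → Ideal⟨ Gen ⟩ (h ⊗ g)
  generator-multiple∈Ideal h g gen =
    (h , g) ∷ [] , gen ∷ [] , λ m → ≈-sym (≈-trans (coeff-⊕ (h ⊗ g) [] m) (+-identityʳ _))

  Ideal-mono : ∀ {Gen Gen′} → (∀ {g} → Gen g → Gen′ g) → ∀ f → Ideal⟨ Gen ⟩ f → Ideal⟨ Gen′ ⟩ f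
  Ideal-mono Gen⊆Gen′ f (L , gens , f≈L) = L , All.map Gen⊆Gen′ gens , f≈L

  Ideal-least : ∀ {Gen I} → AdditivelyClosed I → (∀ h g → Gen g → I (h ⊗ g)) →
    ∀ f → Ideal⟨ Gen ⟩ f → I f
  Ideal-least {Gen} {I} I-closed multiple∈I f (L , gens , f≈L) =
    ∈-resp-≈P I-closed (λ m → ≈-sym (f≈L m)) (linComb∈I L gens)
    where
      linComb∈I : ∀ L → All (λ hg → Gen (proj₂ hg)) L → I (linComb L)
      linComb∈I []            []           = []∈ I-closed
      linComb∈I ((h , g) ∷ L) (gen ∷ gens) = ⊕∈ I-closed (multiple∈I h g gen) (linComb∈I L gens)

  +I-closed : ∀ {I J} → AdditivelyClosed I → AdditivelyClosed J → AdditivelyClosed (I +I J)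
  +I-closed I-closed J-closed = record
    { ∈-resp-≈P = λ p≈q (a , b , a∈I , b∈J , p≈a⊕b) →
        a , b , a∈I , b∈J , λ m → ≈-trans (≈-sym (p≈q m)) (p≈a⊕b m)
    ; []∈       = [] , [] , []∈ I-closed , []∈ J-closed , λ m → ≈-refl
    ; ⊕∈        = λ {p} {q} (a , b , a∈I , b∈J , p≈a⊕b) (a′ , b′ , a′∈I , b′∈J , q≈a′⊕b′) →
        a ⊕ a′ , b ⊕ b′ , ⊕∈ I-closed a∈I a′∈I , ⊕∈ J-closed b∈J b′∈J , λ m → begin
          coeff (p ⊕ q) m                                     ≈⟨ ⊕-cong {p} {a ⊕ b} p≈a⊕b q≈a′⊕b′ m ⟩
          coeff ((a ⊕ b) ⊕ (a′ ⊕ b′)) m                       ≈⟨ coeff-⊕ (a ⊕ b) _ m ⟩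
          coeff (a ⊕ b) m + coeff (a′ ⊕ b′) m                 ≈⟨ +-cong (coeff-⊕ a b m) (coeff-⊕ a′ b′ m) ⟩
          (coeff a m + coeff b m) + (coeff a′ m + coeff b′ m) ≈⟨ interchange _ _ _ _ ⟩
          (coeff a m + coeff a′ m) + (coeff b m + coeff b′ m) ≈⟨ +-cong (coeff-⊕ a a′ m) (coeff-⊕ b b′ m) ⟨
          coeff (a ⊕ a′) m + coeff (b ⊕ b′) m                 ≈⟨ coeff-⊕ (a ⊕ a′) _ m ⟨
          coeff ((a ⊕ a′) ⊕ (b ⊕ b′)) m                       ∎
    }

  ∈+I-left : ∀ {I J} → AdditivelyClosed J → ∀ p → I p → (I +I J) p
  ∈+I-left J-closed p p∈I =
    p , [] , p∈I , []∈ J-closed , λ m → ≈-sym (≈-trans (coeff-⊕ p [] m) (+-identityʳ _))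

  ∈+I-right : ∀ {I J} → AdditivelyClosed I → ∀ p → J p → (I +I J) p
  ∈+I-right I-closed p p∈J = [] , p , []∈ I-closed , p∈J , λ m → ≈-refl

  +I-least : ∀ {A B I} → AdditivelyClosed I → (∀ f → A f → I f) → (∀ f → B f → I f) →
    ∀ f → (A +I B) f → I f
  +I-least I-closed A⊆I B⊆I f (a , b , a∈A , b∈B , f≈a⊕b) =
    ∈-resp-≈P I-closed (λ mo → ≈-sym (f≈a⊕b mo)) (⊕∈ I-closed (A⊆I a a∈A) (B⊆I b b∈B))

  -- The test φcoeff applies to a term whose monomial has φ-exponent x.
  hits : Vec ℕ d × ℕ → Vec ℕ d → ℕ → Bool
  hits x e k = does (≡-dec _≟ℕ_ (proj₁ x) e) ∧ does (proj₂ x ≟ℕ k)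

  hits-self : ∀ x → hits x (proj₁ x) (proj₂ x) ≡ true
  hits-self x = cong₂ _∧_ (dec-true (≡-dec _≟ℕ_ (proj₁ x) _) refl) (dec-true (proj₂ x ≟ℕ _) refl)

  hits-≢ : ∀ {x y} → y ≢ x → hits y (proj₁ x) (proj₂ x) ≡ false
  hits-≢ {x} {y} y≢x with ≡-dec _≟ℕ_ (proj₁ y) (proj₁ x)
  ... | no _   = refl
  ... | yes eu = dec-false (proj₂ y ≟ℕ proj₂ x) (λ ek → y≢x (cong₂ _,_ eu ek))

  φcoeff-binomial : ∀ {a b} m n {e k x y} → hits (φexp m) e k ≡ x → hits (φexp n) e k ≡ y →
    φcoeff (binomial a m b n) e k ≡ (if x then a else 0#) + ((if y then b else 0#) + 0#)
  φcoeff-binomial m n refl refl = refl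

  if-+ : ∀ x {a b} → (if x then a else 0#) + ((if x then b else 0#) + 0#) ≈ (if x then a + b else 0#)
  if-+ true  {a} {b} = +-congˡ (+-identityʳ b)
  if-+ false         = ≈-trans (+-identityˡ _) (+-identityˡ 0#)

  InI-binomial : ∀ {a b} m n → φexp m ≡ φexp n → a + b ≈ 0# → InI (binomial a m b n)
  InI-binomial m n φm≡φn a+b≈0 e k =
    ≈-trans (reflexive (φcoeff-binomial m n refl (cong (λ x → hits x e k) (sym φm≡φn))))
      (≈-trans (if-+ (hits (φexp m) e k)) (if-≈0 (hits (φexp m) e k) a+b≈0))

  InI-binomial⇒+≈0 : ∀ {a b} m n → InI (binomial a m b n) → φexp m ≡ φexp n → a + b ≈ 0#
  InI-binomial⇒+≈0 {a} {b} m n ker φm≡φn = begin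
    a + b                         ≈⟨ +-congˡ (+-identityʳ b) ⟨
    a + (b + 0#)                  ≡⟨ φcoeff-binomial m n (hits-self (φexp m)) n-hits ⟨
    φcoeff (binomial a m b n) _ _ ≈⟨ ker _ _ ⟩
    0#                            ∎
    where
      n-hits : hits (φexp n) (proj₁ (φexp m)) (proj₂ (φexp m)) ≡ true
      n-hits = subst (λ x → hits x _ _ ≡ true) φm≡φn (hits-self (φexp m))

  InI-binomial⇒≈0 : ∀ {a b} m n → InI (binomial a m b n) → φexp m ≢ φexp n → a ≈ 0# × b ≈ 0#
  InI-binomial⇒≈0 {a} {b} m n ker φm≢φn = a≈0 , b≈0
    where
      a≈0 : a ≈ 0#
      a≈0 = begin
        a                             ≈⟨ ≈-trans (+-congˡ (+-identityˡ 0#)) (+-identityʳ a) ⟨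
        a + (0# + 0#)                 ≡⟨ φcoeff-binomial m n (hits-self (φexp m)) (hits-≢ (φm≢φn ∘ sym)) ⟨
        φcoeff (binomial a m b n) _ _ ≈⟨ ker _ _ ⟩
        0#                            ∎
      b≈0 : b ≈ 0#
      b≈0 = begin
        b                             ≈⟨ ≈-trans (+-identityˡ _) (+-identityʳ b) ⟨
        0# + (b + 0#)                 ≡⟨ φcoeff-binomial m n (hits-≢ φm≢φn) (hits-self (φexp n)) ⟨
        φcoeff (binomial a m b n) _ _ ≈⟨ ker _ _ ⟩
        0#                            ∎

  lookup-φexp-∷ : ∀ X m i →
    lookup (proj₁ (φexp (X ∷ m))) i ≡ χ (lookup (proj₁ X) i) +ℕ lookup (proj₁ (φexp m)) i
  lookup-φexp-∷ X m i =
    trans (lookup-zipWith _+ℕ_ i (indicator (proj₁ X)) _) (cong (_+ℕ _) (lookup∘tabulate _ i))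

  lookup-φexp-pair : ∀ X Y i →
    lookup (proj₁ (φexp (X ∷ Y ∷ []))) i ≡ χ (lookup (proj₁ X) i) +ℕ χ (lookup (proj₁ Y) i)
  lookup-φexp-pair X Y i =
    trans (lookup-φexp-∷ X (Y ∷ []) i) (cong (χ (lookup (proj₁ X) i) +ℕ_)
      (trans (lookup-φexp-∷ Y [] i)
        (trans (cong (χ (lookup (proj₁ Y) i) +ℕ_) (lookup-replicate i 0)) (ℕ.+-identityʳ _))))

  lookup-φexp-pair-∩∪ : ∀ X Y i → lookup (proj₁ (φexp (X ∷ Y ∷ []))) i ≡
    χ (lookup (proj₁ X ∩ proj₁ Y) i) +ℕ χ (lookup (proj₁ X ∪ proj₁ Y) i)
  lookup-φexp-pair-∩∪ X Y i =
    trans (lookup-φexp-pair X Y i) (trans (χ-+≡χ-∧+χ-∨ (lookup (proj₁ X) i) (lookup (proj₁ Y) i))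
      (sym (cong₂ (λ s t → χ s +ℕ χ t)
             (lookup-zipWith _∧_ i (proj₁ X) _) (lookup-zipWith _∨_ i (proj₁ X) _))))

  φexp-pair≡⇔∩∪≡ : ∀ S T U V → φexp (S ∷ T ∷ []) ≡ φexp (U ∷ V ∷ []) ⇔
    (proj₁ S ∩ proj₁ T ≡ proj₁ U ∩ proj₁ V × proj₁ S ∪ proj₁ T ≡ proj₁ U ∪ proj₁ V)
  φexp-pair≡⇔∩∪≡ S T U V = mk⇔ to from
    where
      ∩∪≡ : Set
      ∩∪≡ = proj₁ S ∩ proj₁ T ≡ proj₁ U ∩ proj₁ V × proj₁ S ∪ proj₁ T ≡ proj₁ U ∪ proj₁ V
      to : φexp (S ∷ T ∷ []) ≡ φexp (U ∷ V ∷ []) → ∩∪≡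
      to φ≡ = lookup-extensionality (λ i → pointwise _∧_ i (proj₁ (∧-∨≡ i)))
            , lookup-extensionality (λ i → pointwise _∨_ i (proj₂ (∧-∨≡ i)))
        where
          s t u v : Fin d → Bool
          s = lookup (proj₁ S)
          t = lookup (proj₁ T)
          u = lookup (proj₁ U)
          v = lookup (proj₁ V)
          ∧-∨≡ : ∀ i → s i ∧ t i ≡ u i ∧ v i × s i ∨ t i ≡ u i ∨ v i
          ∧-∨≡ i = χ-+⇒∧-∨ (s i) (t i) (u i) (v i) (trans (sym (lookup-φexp-pair S T i))
                     (trans (cong (λ x → lookup (proj₁ x) i) φ≡) (lookup-φexp-pair U V i)))
          pointwise : ∀ _•_ i → s i • t i ≡ u i • v i →
            lookup (zipWith _•_ (proj₁ S) (proj₁ T)) i ≡ lookup (zipWith _•_ (proj₁ U) (proj₁ V)) i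
          pointwise _•_ i eq =
            trans (lookup-zipWith _•_ i (proj₁ S) _) (trans eq (sym (lookup-zipWith _•_ i (proj₁ U) _)))
      from : ∩∪≡ → φexp (S ∷ T ∷ []) ≡ φexp (U ∷ V ∷ [])
      from (∩≡ , ∪≡) = cong₂ _,_ (lookup-extensionality λ i →
        trans (lookup-φexp-pair-∩∪ S T i)
          (trans (cong₂ (λ p q → χ (lookup p i) +ℕ χ (lookup q i)) ∩≡ ∪≡)
                 (sym (lookup-φexp-pair-∩∪ U V i)))) refl

  Meets : Var G → Var G → Set
  Meets S T = Σ (Fin d) λ i → i ∈ proj₁ S × i ∈ proj₁ T

  meets? : ∀ S T → Dec (Meets S T)
  meets? S T = any? λ i → (i ∈? proj₁ S) ×-dec (i ∈? proj₁ T)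

  Meets-resp-∩ : ∀ {S T U V} → proj₁ S ∩ proj₁ T ≡ proj₁ U ∩ proj₁ V → Meets S T → Meets U V
  Meets-resp-∩ {U = U} {V} ∩≡ (i , i∈S , i∈T) =
    i , x∈p∩q⁻ (proj₁ U) (proj₁ V) (subst (i ∈_) ∩≡ (x∈p∩q⁺ (i∈S , i∈T)))

  ¬Meets⇒∩≡∅ : ∀ {S T} → ¬ Meets S T → proj₁ S ∩ proj₁ T ≡ ∅
  ¬Meets⇒∩≡∅ {S} {T} S∥T = Empty-unique λ (i , i∈S∩T) → S∥T (i , x∈p∩q⁻ (proj₁ S) (proj₁ T) i∈S∩T)

  no-edge-in-stable : ∀ (X : Var G) {i j} → i ∈ proj₁ X → j ∈ proj₁ X → Adj G i j ≢ true
  no-edge-in-stable (X , stable) i∈X j∈X adj with trans (sym adj) (stable _ _ i∈X j∈X)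
  ... | ()

  ∈∪∧∉⇒∈ : ∀ {p q : Subset d} {i} → i ∈ p ∪ q → ¬ i ∈ p → i ∈ q
  ∈∪∧∉⇒∈ {p} {q} i∈p∪q i∉p = [ (λ i∈p → ⊥-elim (i∉p i∈p)) , (λ i∈q → i∈q) ]′ (x∈p∪q⁻ p q i∈p∪q)

  -- W is only required to equal S ∪ T so that U and V can colour S ∪ T = U ∪ V as well.
  splitColoring : ∀ (S T : Var G) {W} → W ≡ proj₁ S ∪ proj₁ T → Coloring G W
  splitColoring S T refl = record { col = lookup (proj₁ S) ; proper = proper }
    where
      same-side : ∀ {i j} → lookup (proj₁ S) i ≡ lookup (proj₁ S) j → i ∈ proj₁ S → j ∈ proj₁ S
      same-side same i∈S = lookup⇒[]= _ _ (trans (sym same) ([]=⇒lookup i∈S))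
      proper : ∀ i j → i ∈ proj₁ S ∪ proj₁ T → j ∈ proj₁ S ∪ proj₁ T → Adj G i j ≡ true →
        lookup (proj₁ S) i ≢ lookup (proj₁ S) j
      proper i j i∈W j∈W adj same with i ∈? proj₁ S
      ... | yes i∈S = no-edge-in-stable S i∈S (same-side same i∈S) adj
      ... | no  i∉S = no-edge-in-stable T (∈∪∧∉⇒∈ i∈W i∉S)
                        (∈∪∧∉⇒∈ j∈W (λ j∈S → i∉S (same-side (sym same) j∈S))) adj

  colorClass1-split : ∀ S T {W} (W≡S∪T : W ≡ proj₁ S ∪ proj₁ T) →
    colorClass1 (splitColoring S T W≡S∪T) ≡ proj₁ S
  colorClass1-split S T refl = trans (tabulate-cong λ i →
      trans (cong (_∧ lookup (proj₁ S) i) (lookup-zipWith _∨_ i (proj₁ S) (proj₁ T)))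
            (trans (∧-comm (lookup (proj₁ S) i ∨ lookup (proj₁ T) i) _)
                   (∧-abs-∨ _ (lookup (proj₁ T) i))))
    (tabulate∘lookup (proj₁ S))

  colorClass2-split : ∀ S T {W} (W≡S∪T : W ≡ proj₁ S ∪ proj₁ T) → proj₁ S ∩ proj₁ T ≡ ∅ →
    colorClass2 (splitColoring S T W≡S∪T) ≡ proj₁ T
  colorClass2-split S T refl S∩T≡∅ = trans (tabulate-cong λ i →
      trans (cong (_∧ _) (lookup-zipWith _∨_ i (proj₁ S) (proj₁ T)))
            (∨-∧-¬ˡ-disjoint _ _ (disjoint i)))
    (tabulate∘lookup (proj₁ T))
    where
      disjoint : ∀ i → lookup (proj₁ S) i ∧ lookup (proj₁ T) i ≡ false
      disjoint i = trans (sym (lookup-zipWith _∧_ i (proj₁ S) (proj₁ T)))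
                     (trans (cong (λ p → lookup p i) S∩T≡∅) (lookup-replicate i false))

  colorClasses-∩ : ∀ {W} (f : Coloring G W) → colorClass1 f ∩ colorClass2 f ≡ ∅
  colorClasses-∩ {W} f = lookup-extensionality λ i →
    trans (lookup-zipWith _∧_ i (colorClass1 f) _)
      (trans (cong₂ _∧_ (lookup∘tabulate _ i) (lookup∘tabulate _ i))
        (trans (∧-∧¬-disjoint (lookup W i) (Coloring.col f i)) (sym (lookup-replicate i false))))

  colorClasses-∪ : ∀ {W} (f : Coloring G W) → colorClass1 f ∪ colorClass2 f ≡ W
  colorClasses-∪ {W} f = lookup-extensionality λ i →
    trans (lookup-zipWith _∨_ i (colorClass1 f) _)
      (trans (cong₂ _∨_ (lookup∘tabulate _ i) (lookup∘tabulate _ i))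
        (∧-∨∧¬-covers (lookup W i) (Coloring.col f i)))

  JGen-binomial : ∀ S T U V → proj₁ S ∩ proj₁ T ≡ ∅ → proj₁ U ∩ proj₁ V ≡ ∅ →
    proj₁ S ∪ proj₁ T ≡ proj₁ U ∪ proj₁ V → JGen (binomial 1# (S ∷ T ∷ []) (- 1#) (U ∷ V ∷ []))
  JGen-binomial S T U V S∩T≡∅ U∩V≡∅ S∪T≡U∪V =
    lift (proj₁ S ∪ proj₁ T , splitColoring S T refl , splitColoring U V S∪T≡U∪V , S , T , U , V ,
          sym (colorClass1-split S T refl) , sym (colorClass2-split S T refl S∩T≡∅) ,
          sym (colorClass1-split U V S∪T≡U∪V) , sym (colorClass2-split U V S∪T≡U∪V U∩V≡∅) , refl)

  JGen⇒QuadBinomialInI : ∀ {p} → JGen p → QuadBinomialInI p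
  JGen⇒QuadBinomialInI
    (lift (_ , f , g , f₁@(_ , _) , f₂@(_ , _) , g₁@(_ , _) , g₂@(_ , _) , refl , refl , refl , refl , refl)) =
    1# , - 1# , f₁ , f₂ , g₁ , g₂ , refl , InI-binomial (f₁ ∷ f₂ ∷ []) (g₁ ∷ g₂ ∷ []) φ≡ (-‿inverseʳ 1#)
    where
      φ≡ : φexp (f₁ ∷ f₂ ∷ []) ≡ φexp (g₁ ∷ g₂ ∷ [])
      φ≡ = Equivalence.from (φexp-pair≡⇔∩∪≡ f₁ f₂ g₁ g₂)
             ( trans (colorClasses-∩ f) (sym (colorClasses-∩ g))
             , trans (colorClasses-∪ f) (sym (colorClasses-∪ g)))

  QuadBinomialInI-multiple∈I : ∀ {I} → AdditivelyClosed I →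
    (∀ h g → JGen g → I (h ⊗ g)) → (∀ h g → MGen g → I (h ⊗ g)) →
    ∀ h p → QuadBinomialInI p → I (h ⊗ p)
  QuadBinomialInI-multiple∈I I-closed J-multiple∈I M-multiple∈I h _ (a , b , S , T , U , V , refl , ker)
    with Product.≡-dec (≡-dec _≟ℕ_) _≟ℕ_ (φexp (S ∷ T ∷ [])) (φexp (U ∷ V ∷ []))
  ... | no φ≢ =
    let a≈0 , b≈0 = InI-binomial⇒≈0 (S ∷ T ∷ []) (U ∷ V ∷ []) ker φ≢ in
    ∈-resp-≈P I-closed (λ mo → ≈-sym (⊗-binomial-≈0 h a≈0 b≈0 mo)) ([]∈ I-closed)
  ... | yes φ≡ with Equivalence.to (φexp-pair≡⇔∩∪≡ S T U V) φ≡ | meets? S T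
  ...   | ∩≡ , _ | yes S⋈T =
    ∈-resp-≈P I-closed (λ mo → ≈-sym (⊗-binomial-split h a (S ∷ T ∷ []) b (U ∷ V ∷ []) mo))
      (⊕∈ I-closed (M-multiple∈I (scale h a) _ (S , T , S⋈T , lift refl))
                   (M-multiple∈I (scale h b) _ (U , V , Meets-resp-∩ {S} {T} {U} {V} ∩≡ S⋈T , lift refl)))
  ...   | ∩≡ , ∪≡ | no S∥T =
    ∈-resp-≈P I-closed (λ mo → ≈-sym (⊗-binomial-difference h a (S ∷ T ∷ []) b (U ∷ V ∷ []) b≈-a mo))
      (J-multiple∈I (scale h a) _ (JGen-binomial S T U V S∩T≡∅ (trans (sym ∩≡) S∩T≡∅) ∪≡))
    where
      S∩T≡∅ : proj₁ S ∩ proj₁ T ≡ ∅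
      S∩T≡∅ = ¬Meets⇒∩≡∅ {S} {T} S∥T
      b≈-a : b ≈ - a
      b≈-a = +-inverseʳ-unique a b (InI-binomial⇒+≈0 (S ∷ T ∷ []) (U ∷ V ∷ []) ker φ≡)

  K-closed : AdditivelyClosed K-G
  K-closed = +I-closed (Ideal-closed JGen) (Ideal-closed MGen)

  J⊆K : ∀ f → J-G f → K-G f
  J⊆K = ∈+I-left (Ideal-closed MGen)

  M⊆K : ∀ f → M-G f → K-G f
  M⊆K = ∈+I-right (Ideal-closed JGen)

  Q⊆K : ∀ f → Q-G f → K-G f
  Q⊆K = Ideal-least K-closed (QuadBinomialInI-multiple∈I K-closed
    (λ h g → J⊆K (h ⊗ g) ∘ generator-multiple∈Ideal h g)
    (λ h g → M⊆K (h ⊗ g) ∘ generator-multiple∈Ideal h g))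

  K⊆Q+M : ∀ f → K-G f → (Q-G +I M-G) f
  K⊆Q+M f (a , b , a∈J , b∈M , f≈a⊕b) =
    a , b , Ideal-mono JGen⇒QuadBinomialInI a a∈J , b∈M , f≈a⊕b

  Q+M⊆K : ∀ f → (Q-G +I M-G) f → K-G f
  Q+M⊆K = +I-least K-closed Q⊆K M⊆K

corollary6p2 : {c ℓ : Level} (K : CommutativeRing c ℓ) → IsField K →
    (d : ℕ) (G : SimpleGraph d) (f : PolyRing.Poly K G) →
    PolyRing.K-G K G f ⇔ (PolyRing._+I_ K G (PolyRing.Q-G K G) (PolyRing.M-G K G)) f
corollary6p2 K _ d G f = mk⇔ (K⊆Q+M K G f) (Q+M⊆K K G f)
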